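{- Assume that for every integer $n>2$, $n$ does not divide $!n$. Then for every integer $m>1$ there are at most finitely many positive integers $n$ such that $m^2$ divides $!n$.
   Context: For a positive integer $n$, the left factorial is $!n=\sum_{i=0}^{n-1} i!$. -}

module Defs where

open import Data.Nat using (ℕ; zero; suc; _+_; _!)

leftFactorial : ℕ → ℕ
leftFactorial zero    = 0
leftFactorial (suc n) = leftFactorial n + n !

-- Once n ≥ K, every further summand j! of !n is divisible by K, so K ∣ !n forces K ∣ !K.
-- Taking K = m² > 2 contradicts the hypothesis, hence m² ∣ !n implies n ≤ m².
module Submission where

open import Defs
open import Data.Nat using (ℕ; zero; suc; _+_; _*_; _!; _≤_; _<_; NonZero; >-nonZero; z<s; s≤s; z≤n)
open import Data.Nat.Divisibility using (_∣_; ∣-trans; m∣m*n; ∣m+n∣m⇒∣n; m≤n⇒m!∣n!)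
open import Data.Nat.Properties
  using (m≤m+n; +-identityʳ; +-suc; +-comm; <-≤-trans; <-trans; *-mono-≤; _≤?_; ≰⇒≥; m≤n⇒∃[o]m+o≡n)
open import Data.Product using (∃-syntax; _,_)
open import Relation.Nullary using (¬_; yes; no; contradiction)
open import Relation.Binary.PropositionalEquality using (subst; sym)

m≤n⇒m∣n! : ∀ {m n} → .{{NonZero m}} → m ≤ n → m ∣ n !
m≤n⇒m∣n! {suc k} m≤n = ∣-trans (m∣m*n (k !)) (m≤n⇒m!∣n! m≤n)

∣leftFactorial[n+i]⇒∣leftFactorial[n] : ∀ {d} n i → (∀ {j} → n ≤ j → d ∣ j !) →
                                        d ∣ leftFactorial (n + i) → d ∣ leftFactorial n
∣leftFactorial[n+i]⇒∣leftFactorial[n] {d} n zero _ d∣lf =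
  subst (λ k → d ∣ leftFactorial k) (+-identityʳ n) d∣lf
∣leftFactorial[n+i]⇒∣leftFactorial[n] {d} n (suc i) d∣j! d∣lf =
  ∣leftFactorial[n+i]⇒∣leftFactorial[n] n i d∣j! (∣m+n∣m⇒∣n d∣sum (d∣j! (m≤m+n n i)))
  where
  d∣sum : d ∣ (n + i) ! + leftFactorial (n + i)
  d∣sum = subst (d ∣_) (+-comm (leftFactorial (n + i)) ((n + i) !))
                (subst (λ k → d ∣ leftFactorial k) (+-suc n i) d∣lf)

proposition2p3p1 : (∀ (n : ℕ) → 2 < n → ¬ (n ∣ leftFactorial n))
    → ∀ (m : ℕ) → 1 < m → ∃[ N ] (∀ (n : ℕ) → 1 ≤ n → m * m ∣ leftFactorial n → n ≤ N)
proposition2p3p1 n∤!n m 1<m = m * m , bounded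
  where
  2<m*m : 2 < m * m
  2<m*m = <-≤-trans (s≤s (s≤s (s≤s z≤n))) (*-mono-≤ 1<m 1<m)

  instance
    m*m≢0 : NonZero (m * m)
    m*m≢0 = >-nonZero (<-trans z<s 2<m*m)

  bounded : ∀ n → 1 ≤ n → m * m ∣ leftFactorial n → n ≤ m * m
  bounded n _ m*m∣!n with n ≤? m * m
  ... | yes n≤m*m = n≤m*m
  ... | no n≰m*m with m≤n⇒∃[o]m+o≡n (≰⇒≥ n≰m*m)
  ...   | i , m*m+i≡n =
    contradiction (∣leftFactorial[n+i]⇒∣leftFactorial[n] (m * m) i m≤n⇒m∣n!
                     (subst (λ k → m * m ∣ leftFactorial k) (sym m*m+i≡n) m*m∣!n))
                  (n∤!n (m * m) 2<m*m)
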